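{- Let $A$ be a set of prime powers with $|A| \ge 3$ such that, whenever $q$ is a prime dividing $\prod_{a \in B} a - 1$ for some $B \in \mathcal P_\star(A)$, $q$ divides some element of $A$. Then every prime divides some element of $A$. In particular, if $A$ consists of primes only, then $A$ is the set of all primes.
   Context: A prime power is a number of the form $p^k$ with $p$ prime and $k \ge 1$. For a set $X$, $\mathcal P_\star(X)$ denotes the family of all finite nonempty proper subsets of $X$. -}

module Defs where

open import Data.Nat using (ℕ; _≥_; _∸_)
open import Data.Nat.Primality using (Prime)
open import Data.Nat.Divisibility using (_∣_)
open import Data.Product using (Σ; ∃; _×_; ∃-syntax)
open import Data.List using (List; _∷_)
open import Data.Nat.ListAction using (product)
open import Data.List.Membership.Propositional using (_∈_; _∉_)
open import Data.List.Relation.Unary.Unique.Propositional using (Unique)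
open import Data.List.Relation.Unary.All using (All)
open import Relation.Binary.PropositionalEquality using (_≡_; _≢_)
open import Data.Nat using (_^_)

Subset : Set₁
Subset = ℕ → Set

IsPrimePower : ℕ → Set
IsPrimePower n = ∃[ p ] ∃[ k ] (Prime p × k ≥ 1 × n ≡ p ^ k)

AtLeast3 : Subset → Set
AtLeast3 A = ∃[ a ] ∃[ b ] ∃[ c ]
  (A a × A b × A c × a ≢ b × a ≢ c × b ≢ c)

-- B ∈ 𝒫⋆(A): a finite nonempty proper subset of A, represented by a
-- duplicate-free list of its elements
record FinNonemptyProperSubset (A : Subset) (B : List ℕ) : Set where
  field
    distinct : Unique B
    inA      : All A B
    nonempty : ∃[ x ] (x ∈ B)
    proper   : ∃[ x ] (A x × x ∉ B)

ClosedHyp : Subset → Set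
ClosedHyp A = ∀ (B : List ℕ) → FinNonemptyProperSubset A B →
  ∀ (q : ℕ) → Prime q → q ∣ (product B ∸ 1) → ∃[ a ] (A a × q ∣ a)

module Submission where

-- (1) Pigeonhole.  If A contains p distinct elements, p prime, then p
--     divides an element of A: otherwise p of the prefix products of p − 1
--     of them have nonzero residues mod p, two of them agree, and p divides
--     ∏S − 1 for the block S between the two cuts, a proper subset of A.
-- (2) Growth.  By (1) for p = 2, 3, A contains powers 2^k and 3^l.  For a
--     nonempty list O of elements of A prime to 6 with product R, each of
--     2^k R − 1, 3^l R − 1, R − 1 is either divisible by a prime q ≥ 5,
--     which divides a new element of A prime to 6, or is {2,3}-smooth.
--     The three smooth equations 2^k R = 1 + 3^b, 3^l R = 1 + 2^a,
--     R = 1 + 2^c 3^d have no common solution (congruences modulo 3, 7, 8,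
--     9, 15, 80), so A contains arbitrarily many elements.
-- (3) Applying (1) to p of them proves that every prime p divides an
--     element of A; if A consists of primes, that element is p itself.

open import Defs
open import Data.Nat
open import Data.Nat.Properties
open import Data.Nat.DivMod
open import Data.Nat.Divisibility
open import Data.Nat.Primality
open import Data.Nat.Primality.Factorisation using (factorise)
open import Data.Nat.ListAction using (product)
open import Data.Nat.ListAction.Properties using (product-++; ∈⇒∣product; ∈⇒≤product)
open import Data.Nat.Tactic.RingSolver using (solve-∀)
open import Data.List using (List; []; _∷_; length; take; drop; _++_)
open import Data.List.Properties using (take-take; take++drop≡id)
open import Data.List.Membership.Propositional using (_∈_)
open import Data.List.Membership.DecPropositional _≟_ using (_∈?_)
open import Data.List.Relation.Unary.All as All using (All; []; _∷_; all?)
import Data.List.Relation.Unary.All.Properties as All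
open import Data.List.Relation.Unary.All.Properties.Core using (¬Any⇒All¬)
open import Data.List.Relation.Unary.Any as Any using (here; there; any?)
open import Data.List.Relation.Unary.Unique.Propositional using (Unique)
import Data.List.Relation.Unary.Unique.Propositional.Properties as Unique
open import Data.List.Relation.Unary.AllPairs using ([]; _∷_)
open import Data.Fin as Fin using (Fin; toℕ; fromℕ<)
open import Data.Fin.Properties using (pigeonhole; toℕ-fromℕ<; toℕ<n)
open import Data.Product using (_×_; _,_; ∃-syntax; proj₂)
open import Data.Sum using (_⊎_; inj₁; inj₂)
open import Data.Empty using (⊥; ⊥-elim)
open import Relation.Nullary using (¬_; ¬?; yes; no)
open import Relation.Nullary.Decidable using (from-yes; True; toWitness)
open import Relation.Binary.PropositionalEquality
open ≡-Reasoning

prime>1 : ∀ {p} → Prime p → 1 < p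
prime>1 {p} pp = nonTrivial⇒n>1 p {{prime⇒nonTrivial pp}}

prime[3] : Prime 3
prime[3] = from-yes (prime? 3)

prime∣prime⇒≡ : ∀ {p q} → Prime p → Prime q → p ∣ q → p ≡ q
prime∣prime⇒≡ pp pq p∣q with prime⇒irreducible pq p∣q
... | inj₁ refl = ⊥-elim (¬prime[1] pp)
... | inj₂ p≡q  = p≡q

prime∣prime^⇒≡ : ∀ {p q} k → Prime p → Prime q → p ∣ q ^ k → p ≡ q
prime∣prime^⇒≡ zero    pp pq p∣1 = ⊥-elim (¬prime[1] (subst Prime (∣1⇒≡1 p∣1) pp))
prime∣prime^⇒≡ (suc k) pp pq p∣q^k+1 with euclidsLemma _ _ pp p∣q^k+1
... | inj₁ p∣q   = prime∣prime⇒≡ pp pq p∣q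
... | inj₂ p∣q^k = prime∣prime^⇒≡ k pp pq p∣q^k

prime∤pred : ∀ {q n} → Prime q → 1 ≤ n → q ∣ n → ¬ q ∣ n ∸ 1
prime∤pred {q} {suc n} pq _ q∣n+1 q∣n =
  ¬prime[1] (subst Prime (∣1⇒≡1 (∣m+n∣m⇒∣n (subst (q ∣_) (+-comm 1 n) q∣n+1) q∣n)) pq)

prime∤product : ∀ {q} → Prime q → ∀ {xs} → All (λ x → ¬ q ∣ x) xs → ¬ q ∣ product xs
prime∤product pq []          q∣1 = ¬prime[1] (subst Prime (∣1⇒≡1 q∣1) pq)
prime∤product pq (q∤x ∷ q∤xs) q∣x*xs with euclidsLemma _ _ pq q∣x*xs
... | inj₁ q∣x  = q∤x q∣x
... | inj₂ q∣xs = prime∤product pq q∤xs q∣xs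

2∤3^ : ∀ l → ¬ 2 ∣ 3 ^ l
2∤3^ l 2∣3^l with prime∣prime^⇒≡ l prime[2] prime[3] 2∣3^l
... | ()

r∣r^ : ∀ r k → 1 ≤ k → r ∣ r ^ k
r∣r^ r (suc k) _ = m∣m*n (r ^ k)

r≤r^ : ∀ r .{{_ : NonZero r}} k → 1 ≤ k → r ≤ r ^ k
r≤r^ r (suc k) _ = m≤m*n r (r ^ k) {{m^n≢0 r k}}

prime-power-base : ∀ {z q} → IsPrimePower z → Prime q → q ∣ z → ∃[ j ] (1 ≤ j × z ≡ q ^ j)
prime-power-base (r , j , pr , j≥1 , refl) pq q∣r^j with prime∣prime^⇒≡ j pq pr q∣r^j
... | refl = j , j≥1 , refl

prime-power≥2 : ∀ {z} → IsPrimePower z → 2 ≤ z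
prime-power≥2 (r , j , pr , j≥1 , refl) =
  ≤-trans (prime>1 pr) (r≤r^ r {{>-nonZero (<-trans z<s (prime>1 pr))}} j j≥1)

prime-power-coprime : ∀ {z q s} → IsPrimePower z → Prime q → Prime s → q ∣ z → q ≢ s → ¬ s ∣ z
prime-power-coprime ppz pq ps q∣z q≢s s∣z with prime-power-base ppz pq q∣z
... | j , _ , refl = q≢s (sym (prime∣prime^⇒≡ j ps pq s∣z))

-- {2,3}-smooth numbers

Smooth : ℕ → Set
Smooth N = ∃[ α ] ∃[ β ] (N ≡ 2 ^ α * 3 ^ β)

LargeFactor : ℕ → Set
LargeFactor N = ∃[ q ] (Prime q × q ∣ N × q ≢ 2 × q ≢ 3)

large-factor-or-smooth-product : ∀ {fs} → All Prime fs →
  (∃[ q ] (Prime q × q ∈ fs × q ≢ 2 × q ≢ 3)) ⊎ Smooth (product fs)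
large-factor-or-smooth-product [] = inj₂ (0 , 0 , refl)
large-factor-or-smooth-product {f ∷ fs} (pf ∷ pfs) with large-factor-or-smooth-product pfs
... | inj₁ (q , pq , q∈ , q≢2 , q≢3) = inj₁ (q , pq , there q∈ , q≢2 , q≢3)
... | inj₂ (α , β , eq) with f ≟ 2 | f ≟ 3
...   | yes refl | _ = inj₂ (suc α , β , trans (cong (2 *_) eq) (sym (*-assoc 2 (2 ^ α) (3 ^ β))))
...   | no _ | yes refl = inj₂ (α , suc β , trans (cong (3 *_) eq) (x*y*3 (2 ^ α) (3 ^ β)))
  where
  x*y*3 : ∀ X Y → 3 * (X * Y) ≡ X * (3 * Y)
  x*y*3 = solve-∀
...   | no f≢2 | no f≢3 = inj₁ (f , pf , here refl , f≢2 , f≢3)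

large-factor-or-smooth : ∀ N .{{_ : NonZero N}} → LargeFactor N ⊎ Smooth N
large-factor-or-smooth N with factorise N
... | record { factors = fs ; isFactorisation = N≡∏fs ; factorsPrime = pfs }
    with large-factor-or-smooth-product pfs
... | inj₁ (q , pq , q∈ , q≢2 , q≢3) = inj₁ (q , pq , subst (q ∣_) (sym N≡∏fs) (∈⇒∣product q∈) , q≢2 , q≢3)
... | inj₂ (α , β , eq) = inj₂ (α , β , trans N≡∏fs eq)

pred-inverse : ∀ {N X} → 1 ≤ N → N ∸ 1 ≡ X → N ≡ 1 + X
pred-inverse 1≤N eq = trans (sym (m+[n∸m]≡n 1≤N)) (cong (1 +_) eq)

even-pred-smooth : ∀ {N} α β → 1 ≤ N → 2 ∣ N → N ∸ 1 ≡ 2 ^ α * 3 ^ β → N ≡ 1 + 3 ^ β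
even-pred-smooth zero    β 1≤N _   eq = pred-inverse 1≤N (trans eq (*-identityˡ (3 ^ β)))
even-pred-smooth (suc α) β 1≤N 2∣N eq =
  ⊥-elim (prime∤pred prime[2] 1≤N 2∣N (subst (2 ∣_) (sym eq) (∣m⇒∣m*n (3 ^ β) (m∣m*n (2 ^ α)))))

three-pred-smooth : ∀ {N} α β → 1 ≤ N → 3 ∣ N → N ∸ 1 ≡ 2 ^ α * 3 ^ β → N ≡ 1 + 2 ^ α
three-pred-smooth α zero    1≤N _   eq = pred-inverse 1≤N (trans eq (*-identityʳ (2 ^ α)))
three-pred-smooth α (suc β) 1≤N 3∣N eq =
  ⊥-elim (prime∤pred prime[3] 1≤N 3∣N (subst (3 ∣_) (sym eq) (∣n⇒∣m*n (2 ^ α) (m∣m*n (3 ^ β)))))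

multiple-of-6-pred-not-smooth : ∀ {N} → 2 < N → 2 ∣ N → 3 ∣ N → ¬ Smooth (N ∸ 1)
multiple-of-6-pred-not-smooth 2<N 2∣N 3∣N (α , zero , eq) =
  <-irrefl refl (subst (2 <_) (even-pred-smooth α 0 (≤-trans (s≤s z≤n) 2<N) 2∣N eq) 2<N)
multiple-of-6-pred-not-smooth 2<N 2∣N 3∣N (α , suc β , eq) =
  prime∤pred prime[3] (≤-trans (s≤s z≤n) 2<N) 3∣N
    (subst (3 ∣_) (sym eq) (∣n⇒∣m*n (2 ^ α) (m∣m*n (3 ^ β))))

-- Residues.  `x % m ∈ rs` records that x lies in one of the classes rs
-- modulo m; the side conditions are finite checks decided by evaluation.

affine-mod : ∀ u v x m .{{_ : NonZero m}} → (u + v * x) % m ≡ (u + v * (x % m)) % m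
affine-mod u v x m = begin
  (u + v * x) % m                               ≡⟨ cong (λ t → (u + v * t) % m) (m≡m%n+[m/n]*n x m) ⟩
  (u + v * (x % m + x / m * m)) % m             ≡⟨ cong (_% m) (regroup u v (x % m) (x / m) m) ⟩
  (u + v * (x % m) + (v * (x / m)) * m) % m     ≡⟨ [m+kn]%n≡m%n (u + v * (x % m)) (v * (x / m)) m ⟩
  (u + v * (x % m)) % m                         ∎
  where
  regroup : ∀ u v r q m → u + v * (r + q * m) ≡ u + v * r + (v * q) * m
  regroup = solve-∀

affine-residue : ∀ m .{{_ : NonZero m}} u v rs ss →
  {True (all? (λ r → (u + v * r) % m ∈? ss) rs)} →
  ∀ x → x % m ∈ rs → (u + v * x) % m ∈ ss
affine-residue m u v rs ss {ok} x x∈rs =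
  subst (_∈ ss) (sym (affine-mod u v x m)) (All.lookup (toWitness ok) x∈rs)

shift-residue : ∀ m .{{_ : NonZero m}} u rs ss →
  {True (all? (λ r → (u + 1 * r) % m ∈? ss) rs)} →
  ∀ x → x % m ∈ rs → (u + x) % m ∈ ss
shift-residue m u rs ss {ok} x x∈rs =
  subst (λ y → (u + y) % m ∈ ss) (*-identityˡ x) (affine-residue m u 1 rs ss {ok} x x∈rs)

power-residues : ∀ m .{{_ : NonZero m}} b rs → {True (1 % m ∈? rs)} →
  {True (all? (λ r → (0 + b * r) % m ∈? rs) rs)} → ∀ w → b ^ w % m ∈ rs
power-residues m b rs {one} zero    = toWitness one
power-residues m b rs {one} {closed} (suc w) =
  affine-residue m 0 b rs rs {closed} (b ^ w) (power-residues m b rs {one} {closed} w)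

residue-clash : ∀ {x y} m .{{_ : NonZero m}} rs ss → {True (all? (λ r → ¬? (r ∈? ss)) rs)} →
  x ≡ y → x % m ∈ rs → y % m ∈ ss → ⊥
residue-clash m rs ss {disjoint} refl x∈rs x∈ss = All.lookup (toWitness disjoint) x∈rs x∈ss

residue-nondivisible : ∀ {x} m .{{_ : NonZero m}} rs → {True (¬? (0 ∈? rs))} → x % m ∈ rs → ¬ m ∣ x
residue-nondivisible {x} m rs {0∉rs} x∈rs m∣x =
  toWitness 0∉rs (subst (_∈ rs) (n∣m⇒m%n≡0 x m m∣x) x∈rs)

8∤1+3^b : ∀ b → ¬ 8 ∣ 1 + 3 ^ b
8∤1+3^b b = residue-nondivisible 8 (2 ∷ 4 ∷ [])
  (shift-residue 8 1 (1 ∷ 3 ∷ []) _ (3 ^ b) (power-residues 8 3 _ b))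

15∤1+2^a : ∀ a → ¬ 15 ∣ 1 + 2 ^ a
15∤1+2^a a = residue-nondivisible 15 (2 ∷ 3 ∷ 5 ∷ 9 ∷ [])
  (shift-residue 15 1 (1 ∷ 2 ∷ 4 ∷ 8 ∷ []) _ (2 ^ a) (power-residues 15 2 _ a))

7∤1+2^a : ∀ a → ¬ 7 ∣ 1 + 2 ^ a
7∤1+2^a a = residue-nondivisible 7 (2 ∷ 3 ∷ 5 ∷ [])
  (shift-residue 7 1 (1 ∷ 2 ∷ 4 ∷ []) _ (2 ^ a) (power-residues 7 2 _ a))

-- the case of Catalan's equation needed here: 3^b = 1 + 2^n with n ≥ 2
-- forces n = 3, since 3^b ≡ 1, 3, 9, 27 (mod 80) while 1 + 2^n ≡ 5 for
-- n = 2 and 1 + 2^n ≡ 17, 33, 49, 65 for n ≥ 4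
catalan : ∀ b n → 3 ^ b ≡ 1 + 2 ^ n → 2 ≤ n → n ≡ 3
catalan b 2 eq _ =
  ⊥-elim (residue-clash 80 (1 ∷ 3 ∷ 9 ∷ 27 ∷ []) (5 ∷ []) eq (power-residues 80 3 _ b) (here refl))
catalan b 1 _  (s≤s ())
catalan b 3 _  _ = refl
catalan b (suc (suc (suc (suc w)))) eq _ =
  ⊥-elim (residue-clash 80 (1 ∷ 3 ∷ 9 ∷ 27 ∷ []) (17 ∷ 33 ∷ 65 ∷ 49 ∷ [])
    (trans eq (cong (1 +_) (^-distribˡ-+-* 2 4 w)))
    (power-residues 80 3 _ b)
    (affine-residue 80 1 16 (1 ∷ 2 ∷ 4 ∷ 8 ∷ 16 ∷ 32 ∷ 64 ∷ 48 ∷ []) _ (2 ^ w) (power-residues 80 2 _ w)))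

doubled-bound : ∀ k c d → 2 ^ k * 2 ≤ 2 ^ k * (1 + 2 ^ c * 3 ^ d)
doubled-bound k c d = *-monoʳ-≤ (2 ^ k) (s≤s (*-mono-≤ (m^n>0 2 c) (m^n>0 3 d)))

-- The Diophantine system 2^k R = 1 + 3^b, 3^l R = 1 + 2^a, R = 1 + 2^c 3^d
-- with R odd and k, l ≥ 1 has no solution; k ≥ 3 is excluded mod 8 and
-- the cases k = 1, 2 are treated separately.

no-solution-k≡1 : ∀ l a b c d → 1 ≤ l → ¬ 2 ∣ 1 + 2 ^ c * 3 ^ d →
  2 ^ 1 * (1 + 2 ^ c * 3 ^ d) ≡ 1 + 3 ^ b → 3 ^ l * (1 + 2 ^ c * 3 ^ d) ≡ 1 + 2 ^ a → ⊥
-- R = 2 is even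
no-solution-k≡1 l a b 0 0 _ odd _ _ = odd ∣-refl
-- R = 1 + 2^(1+c): then 3^b = 1 + 2^(2+c), so c = 1 and 15 ∣ 3^l · 5 = 1 + 2^a
no-solution-k≡1 (suc l) a b (suc c) 0 _ _ E₁ E₂ with catalan b (2 + c) 3^b≡1+2^[2+c] (s≤s (s≤s z≤n))
  where
  expand : ∀ X → 2 * 1 * (1 + 2 * X * 1) ≡ 1 + (1 + 2 * (2 * X))
  expand = solve-∀
  3^b≡1+2^[2+c] : 3 ^ b ≡ 1 + 2 ^ (2 + c)
  3^b≡1+2^[2+c] = suc-injective (trans (sym E₁) (expand (2 ^ c)))
... | refl = 15∤1+2^a a (subst (15 ∣_) E₂ (divides (3 ^ l) (regroup (3 ^ l))))
  where
  regroup : ∀ Y → 3 * Y * 5 ≡ Y * 15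
  regroup = solve-∀
-- d ≥ 1 and b = 0: 2R = 2 although R ≥ 2
no-solution-k≡1 l a 0 c (suc d) _ _ E₁ _ with subst (2 ^ 1 * 2 ≤_) E₁ (doubled-bound 1 c (suc d))
... | s≤s (s≤s ())
-- d, b ≥ 1: 2R ≡ 2 but 1 + 3^b ≡ 1 (mod 3)
no-solution-k≡1 l a (suc b) c (suc d) _ _ E₁ _ =
  residue-clash 3 (2 ∷ []) (1 ∷ []) E₁
    (here (trans (cong (_% 3) (regroup (2 ^ c) (3 ^ d))) ([m+kn]%n≡m%n 2 (2 * (2 ^ c * 3 ^ d)) 3)))
    (here (trans (cong (λ t → (1 + t) % 3) (*-comm 3 (3 ^ b))) ([m+kn]%n≡m%n 1 (3 ^ b) 3)))
  where
  regroup : ∀ X Y → 2 * 1 * (1 + X * (3 * Y)) ≡ 2 + 2 * (X * Y) * 3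
  regroup = solve-∀

no-solution-k≡2 : ∀ l a b c d →
  2 ^ 2 * (1 + 2 ^ c * 3 ^ d) ≡ 1 + 3 ^ b → 3 ^ l * (1 + 2 ^ c * 3 ^ d) ≡ 1 + 2 ^ a → ⊥
-- b ≤ 1: 4R ≥ 8 > 1 + 3^b
no-solution-k≡2 l a 0 c d E₁ _ with subst (2 ^ 2 * 2 ≤_) E₁ (doubled-bound 2 c d)
... | s≤s (s≤s ())
no-solution-k≡2 l a 1 c d E₁ _ with subst (2 ^ 2 * 2 ≤_) E₁ (doubled-bound 2 c d)
... | s≤s (s≤s (s≤s (s≤s ())))
-- d = 0: 4(1 + 2^c) ≡ 2, 0 but 1 + 3^b ≡ 1 (mod 3)
no-solution-k≡2 l a (suc (suc b)) c 0 E₁ _ =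
  residue-clash 3 (2 ∷ 0 ∷ []) (1 ∷ []) E₁
    (subst (λ x → x % 3 ∈ (2 ∷ 0 ∷ [])) (sym (expand (2 ^ c)))
      (affine-residue 3 4 4 (1 ∷ 2 ∷ []) _ (2 ^ c) (power-residues 3 2 _ c)))
    (here (trans (cong (_% 3) (regroup (3 ^ b))) ([m+kn]%n≡m%n 1 (3 * 3 ^ b) 3)))
  where
  expand : ∀ X → 2 * (2 * 1) * (1 + X * 1) ≡ 4 + 4 * X
  expand = solve-∀
  regroup : ∀ Y → 1 + 3 * (3 * Y) ≡ 1 + 3 * Y * 3
  regroup = solve-∀
-- d = 1: 3^(b+1) = 1 + 2^(2+c), so c = 1 and 7 ∣ 3^l · 7 = 1 + 2^a
no-solution-k≡2 l a (suc (suc b)) c 1 E₁ E₂ with catalan (suc b) (2 + c) (sym 1+2^[2+c]≡3^[1+b]) (s≤s (s≤s z≤n))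
  where
  expand : ∀ X → 2 * (2 * 1) * (1 + X * (3 * 1)) ≡ 1 + 3 * (1 + 2 * (2 * X))
  expand = solve-∀
  1+2^[2+c]≡3^[1+b] : 1 + 2 ^ (2 + c) ≡ 3 ^ suc b
  1+2^[2+c]≡3^[1+b] = *-cancelˡ-≡ _ _ 3 (suc-injective (trans (sym (expand (2 ^ c))) E₁))
... | refl = 7∤1+2^a a (subst (7 ∣_) E₂ (divides (3 ^ l) refl))
-- d ≥ 2: 4R ≡ 4 but 1 + 3^b ≡ 1 (mod 9)
no-solution-k≡2 l a (suc (suc b)) c (suc (suc d)) E₁ _ =
  residue-clash 9 (4 ∷ []) (1 ∷ []) E₁
    (here (trans (cong (_% 9) (expand (2 ^ c) (3 ^ d))) ([m+kn]%n≡m%n 4 (4 * (2 ^ c * 3 ^ d)) 9)))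
    (here (trans (cong (_% 9) (regroup (3 ^ b))) ([m+kn]%n≡m%n 1 (3 ^ b) 9)))
  where
  expand : ∀ X Y → 2 * (2 * 1) * (1 + X * (3 * (3 * Y))) ≡ 4 + 4 * (X * Y) * 9
  expand = solve-∀
  regroup : ∀ Y → 1 + 3 * (3 * Y) ≡ 1 + Y * 9
  regroup = solve-∀

no-smooth-solution : ∀ {R} k l a b c d → 1 ≤ k → 1 ≤ l → ¬ 2 ∣ R → R ≡ 1 + 2 ^ c * 3 ^ d →
  2 ^ k * R ≡ 1 + 3 ^ b → 3 ^ l * R ≡ 1 + 2 ^ a → ⊥
no-smooth-solution 1 l a b c d _ l≥1 odd refl E₁ E₂ = no-solution-k≡1 l a b c d l≥1 odd E₁ E₂
no-smooth-solution 2 l a b c d _ _   _   refl E₁ E₂ = no-solution-k≡2 l a b c d E₁ E₂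
no-smooth-solution {R} (suc (suc (suc k))) l a b c d _ _ _ _ E₁ _ =
  8∤1+3^b b (subst (8 ∣_) E₁ (divides (2 ^ k * R) (regroup (2 ^ k) R)))
  where
  regroup : ∀ X Y → 2 * (2 * (2 * X)) * Y ≡ X * Y * 8
  regroup = solve-∀

nonempty-member : ∀ {xs : List ℕ} → 0 < length xs → ∃[ x ] (x ∈ xs)
nonempty-member {x ∷ _} _ = x , here refl

member⇒product≥2 : ∀ {x xs} → All (2 ≤_) xs → x ∈ xs → 2 ≤ product xs
member⇒product≥2 2≤xs x∈xs = ≤-trans (All.lookup 2≤xs x∈xs)
  (∈⇒≤product (All.map (λ 2≤y → >-nonZero (<-trans z<s 2≤y)) 2≤xs) x∈xs)

other-than : ∀ {P : ℕ → Set} {a b c} e h → P a → P b → P c → a ≢ b → a ≢ c → b ≢ c →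
  ∃[ x ] (P x × x ≢ e × x ≢ h)
other-than {a = a} {b} {c} e h Pa Pb Pc a≢b a≢c b≢c with a ≟ e | a ≟ h | b ≟ e | b ≟ h
... | no a≢e  | no a≢h  | _        | _        = a , Pa , a≢e , a≢h
... | _       | _       | no b≢e   | no b≢h   = b , Pb , b≢e , b≢h
... | yes a≡e | _       | yes b≡e  | _        = ⊥-elim (a≢b (trans a≡e (sym b≡e)))
... | _       | yes a≡h | _        | yes b≡h  = ⊥-elim (a≢b (trans a≡h (sym b≡h)))
... | yes a≡e | _       | _        | yes b≡h  =
  c , Pc , (λ c≡e → a≢c (trans a≡e (sym c≡e))) , (λ c≡h → b≢c (trans b≡h (sym c≡h)))
... | _       | yes a≡h | yes b≡e  | _        =
  c , Pc , (λ c≡e → b≢c (trans b≡e (sym c≡e))) , (λ c≡h → a≢c (trans a≡h (sym c≡h)))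

block-product : ∀ {i j} (L : List ℕ) → i ≤ j →
  product (take j L) ≡ product (take i L) * product (drop i (take j L))
block-product {i} {j} L i≤j = begin
  product (take j L)                                         ≡⟨ cong product (take++drop≡id i (take j L)) ⟨
  product (take i (take j L) ++ drop i (take j L))           ≡⟨ product-++ (take i (take j L)) _ ⟩
  product (take i (take j L)) * product (drop i (take j L))  ≡⟨ cong (λ t → product t * product (drop i (take j L))) prefix ⟩
  product (take i L) * product (drop i (take j L))           ∎
  where
  prefix : take i (take j L) ≡ take i L
  prefix = trans (take-take i j L) (cong (λ n → take n L) (m≤n⇒m⊓n≡m i≤j))

block-nonempty : ∀ {i j} (L : List ℕ) → i < j → j ≤ length L → ∃[ x ] (x ∈ drop i (take j L))
block-nonempty {zero}  {suc j} (x ∷ L) _         _         = x , here refl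
block-nonempty {suc i} {suc j} (x ∷ L) (s≤s i<j) (s≤s j≤n) = block-nonempty L i<j j≤n

≡-mod⇒∣∸ : ∀ a b p .{{_ : NonZero p}} → a % p ≡ b % p → p ∣ a ∸ b
≡-mod⇒∣∸ a b p eq = divides (a / p ∸ b / p) (begin
  a ∸ b                                       ≡⟨ cong₂ _∸_ (m≡m%n+[m/n]*n a p) (m≡m%n+[m/n]*n b p) ⟩
  (a % p + a / p * p) ∸ (b % p + b / p * p)   ≡⟨ cong (λ t → (a % p + a / p * p) ∸ (t + b / p * p)) eq ⟨
  (a % p + a / p * p) ∸ (a % p + b / p * p)   ≡⟨ [m+n]∸[m+o]≡n∸o (a % p) _ _ ⟩
  a / p * p ∸ b / p * p                       ≡⟨ *-distribʳ-∸ p (a / p) (b / p) ⟨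
  (a / p ∸ b / p) * p                         ∎)

-- the nonzero residues r modulo 2 + m, coded as r − 1 in Fin (1 + m)
residue-code : ∀ m → ℕ → Fin (suc m)
residue-code m x = fromℕ< (s≤s (pred-mono-≤ (≤-pred (m%n<n x (2 + m)))))

residue-code-injective : ∀ m {x y} → ¬ (2 + m) ∣ x → ¬ (2 + m) ∣ y →
  residue-code m x ≡ residue-code m y → x % (2 + m) ≡ y % (2 + m)
residue-code-injective m {x} {y} p∤x p∤y same = begin
  x % p              ≡⟨ suc-pred (x % p) {{≢-nonZero (nonzero p∤x)}} ⟨
  suc (pred (x % p)) ≡⟨ cong suc pred-equal ⟩
  suc (pred (y % p)) ≡⟨ suc-pred (y % p) {{≢-nonZero (nonzero p∤y)}} ⟩
  y % p              ∎
  where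
  p = 2 + m
  nonzero : ∀ {z} → ¬ p ∣ z → z % p ≢ 0
  nonzero {z} p∤z z%p≡0 = p∤z (m%n≡0⇒n∣m z p z%p≡0)
  pred-equal : pred (x % p) ≡ pred (y % p)
  pred-equal = trans (sym (toℕ-fromℕ< _)) (trans (cong toℕ same) (toℕ-fromℕ< _))

record Anchors (A : Subset) : Set where
  field
    k l    : ℕ
    k≥1    : 1 ≤ k
    l≥1    : 1 ≤ l
    A[2^k] : A (2 ^ k)
    A[3^l] : A (3 ^ l)

module Pigeonhole (A : Subset) (H : ClosedHyp A) where

  -- Step (1): if A contains p distinct elements w, L with p prime, then p
  -- divides an element of A.  The elements of L are multiplied up; w
  -- keeps every block of L a proper subset of A.
  prime-divides-member : ∀ {p} → Prime p → ∀ w L → Unique (w ∷ L) → All A (w ∷ L) →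
    p ≤ length (w ∷ L) → ∃[ a ] (A a × p ∣ a)
  prime-divides-member {suc (suc m)} pp w L (w∉L ∷ distinct) (Aw ∷ AL) (s≤s m<len)
    with any? (λ x → suc (suc m) ∣? x) L
  ... | yes p∣x = Any.lookup p∣x , All.lookupAny AL p∣x
  ... | no  p∤L = collide (pigeonhole (n<1+n (suc m)) (λ i → residue-code m (P i)))
    where
    p = suc (suc m)
    P : Fin p → ℕ
    P i = product (take (toℕ i) L)
    p∤P : ∀ i → ¬ p ∣ P i
    p∤P i = prime∤product pp (All.take⁺ (toℕ i) (¬Any⇒All¬ L p∤L))
    collide : ∃[ i ] ∃[ j ] (i Fin.< j × residue-code m (P i) ≡ residue-code m (P j)) →
      ∃[ a ] (A a × p ∣ a)
    collide (i , j , i<j , same) = H S S∈𝒫⋆ p pp p∣∏S-1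
      where
      S = drop (toℕ i) (take (toℕ j) L)
      S∈𝒫⋆ : FinNonemptyProperSubset A S
      S∈𝒫⋆ = record
        { distinct = Unique.drop⁺ (toℕ i) (Unique.take⁺ (toℕ j) distinct)
        ; inA      = All.drop⁺ (toℕ i) (All.take⁺ (toℕ j) AL)
        ; nonempty = block-nonempty L i<j (≤-trans (≤-pred (toℕ<n j)) m<len)
        ; proper   = w , Aw , λ w∈S → All.lookup (All.drop⁺ (toℕ i) (All.take⁺ (toℕ j) w∉L)) w∈S refl
        }
      -- p divides P j − P i = P i · (∏S − 1), but not P i
      p∣P[i]*[∏S-1] : p ∣ P i * (product S ∸ 1)
      p∣P[i]*[∏S-1] = subst (p ∣_) (begin
        P j ∸ P i                    ≡⟨ cong₂ _∸_ (block-product L (<⇒≤ i<j)) (sym (*-identityʳ (P i))) ⟩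
        P i * product S ∸ P i * 1    ≡⟨ *-distribˡ-∸ (P i) (product S) 1 ⟨
        P i * (product S ∸ 1)        ∎)
        (≡-mod⇒∣∸ (P j) (P i) p (sym (residue-code-injective m (p∤P i) (p∤P j) same)))
      p∣∏S-1 : p ∣ product S ∸ 1
      p∣∏S-1 with euclidsLemma (P i) (product S ∸ 1) pp p∣P[i]*[∏S-1]
      ... | inj₁ p∣P[i] = ⊥-elim (p∤P i p∣P[i])
      ... | inj₂ p∣∏S-1 = p∣∏S-1

  anchors : (∀ a → A a → IsPrimePower a) → AtLeast3 A → Anchors A
  anchors isPP (a , b , c , Aa , Ab , Ac , a≢b , a≢c , b≢c)
    with prime-divides-member prime[2] a (b ∷ []) ((a≢b ∷ []) ∷ [] ∷ []) (Aa ∷ Ab ∷ []) ≤-refl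
       | prime-divides-member prime[3] a (b ∷ c ∷ []) ((a≢b ∷ a≢c ∷ []) ∷ (b≢c ∷ []) ∷ [] ∷ [])
           (Aa ∷ Ab ∷ Ac ∷ []) ≤-refl
  ... | e , Ae , 2∣e | h , Ah , 3∣h
    with prime-power-base (isPP e Ae) prime[2] 2∣e | prime-power-base (isPP h Ah) prime[3] 3∣h
  ... | k , k≥1 , refl | l , l≥1 , refl =
    record { k = k ; l = l ; k≥1 = k≥1 ; l≥1 = l≥1 ; A[2^k] = Ae ; A[3^l] = Ah }

module Growth (A : Subset) (isPP : ∀ a → A a → IsPrimePower a) (H : ClosedHyp A)
              (anchors : Anchors A) where
  open Anchors anchors
  open Pigeonhole A H using (prime-divides-member)

  record Family (n : ℕ) : Set where
    field
      elems    : List ℕ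
      inA      : All A elems
      distinct : Unique elems
      2∤elems  : All (λ x → ¬ 2 ∣ x) elems
      3∤elems  : All (λ x → ¬ 3 ∣ x) elems
      size     : n < length elems

  Fresh : List ℕ → Set
  Fresh O = ∃[ z ] (A z × ¬ 2 ∣ z × ¬ 3 ∣ z × All (z ≢_) O)

  adjoin : ∀ {n} (F : Family n) → Fresh (Family.elems F) → Family (suc n)
  adjoin F (z , Az , 2∤z , 3∤z , z∉elems) = record
    { elems = z ∷ elems ; inA = Az ∷ inA ; distinct = z∉elems ∷ distinct
    ; 2∤elems = 2∤z ∷ 2∤elems ; 3∤elems = 3∤z ∷ 3∤elems ; size = s≤s size }
    where open Family F

  -- For B ∈ 𝒫⋆(A) whose product is a multiple of every element of O, a
  -- prime factor q ≥ 5 of ∏B − 1 divides some z ∈ A; z is a power of q,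
  -- hence prime to 6, and z ∉ O as q ∤ ∏B.
  fresh-or-smooth : ∀ O B → FinNonemptyProperSubset A B → 2 ≤ product B →
    All (_∣ product B) O → Fresh O ⊎ Smooth (product B ∸ 1)
  fresh-or-smooth O B B∈𝒫⋆ 2≤∏B O∣∏B
    with large-factor-or-smooth (product B ∸ 1) {{>-nonZero (m<n⇒0<n∸m 2≤∏B)}}
  ... | inj₂ smooth = inj₂ smooth
  ... | inj₁ (q , pq , q∣∏B-1 , q≢2 , q≢3) with H B B∈𝒫⋆ q pq q∣∏B-1
  ... | z , Az , q∣z = inj₁ (z , Az , prime-power-coprime (isPP z Az) pq prime[2] q∣z q≢2
                                    , prime-power-coprime (isPP z Az) pq prime[3] q∣z q≢3
                                    , All.map z≢ O∣∏B)
    where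
    z≢ : ∀ {x} → x ∣ product B → z ≢ x
    z≢ x∣∏B refl = prime∤pred pq (<-trans z<s 2≤∏B) (∣-trans q∣z x∣∏B) q∣∏B-1

  2^k≢3^l : 2 ^ k ≢ 3 ^ l
  2^k≢3^l eq = 2∤3^ l (subst (2 ∣_) eq (r∣r^ 2 k k≥1))

  2^k∉ : ∀ {O} → All (λ x → ¬ 2 ∣ x) O → All (2 ^ k ≢_) O
  2^k∉ = All.map (λ 2∤x eq → 2∤x (subst (2 ∣_) eq (r∣r^ 2 k k≥1)))

  3^l∉ : ∀ {O} → All (λ x → ¬ 3 ∣ x) O → All (3 ^ l ≢_) O
  3^l∉ = All.map (λ 3∤x eq → 3∤x (subst (3 ∣_) eq (r∣r^ 3 l l≥1)))

  ∏pair : ℕ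
  ∏pair = product (2 ^ k ∷ 3 ^ l ∷ [])

  2<∏pair : 2 < ∏pair
  2<∏pair = ≤-trans (s≤s (s≤s (s≤s z≤n)))
    (*-mono-≤ (r≤r^ 2 k k≥1) (subst (3 ≤_) (sym (*-identityʳ (3 ^ l))) (r≤r^ 3 l l≥1)))

  2∣∏pair : 2 ∣ ∏pair
  2∣∏pair = ∣m⇒∣m*n (3 ^ l * 1) (r∣r^ 2 k k≥1)

  3∣∏pair : 3 ∣ ∏pair
  3∣∏pair = ∣n⇒∣m*n (2 ^ k) (∣m⇒∣m*n 1 (r∣r^ 3 l l≥1))

  pair∈𝒫⋆ : ∀ {w} → A w → w ≢ 2 ^ k → w ≢ 3 ^ l → FinNonemptyProperSubset A (2 ^ k ∷ 3 ^ l ∷ [])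
  pair∈𝒫⋆ {w} Aw w≢2^k w≢3^l = record
    { distinct = (2^k≢3^l ∷ []) ∷ [] ∷ [] ; inA = A[2^k] ∷ A[3^l] ∷ [] ; nonempty = 2 ^ k , here refl
    ; proper = w , Aw , λ { (here w≡2^k) → w≢2^k w≡2^k ; (there (here w≡3^l)) → w≢3^l w≡3^l } }

  -- a first element prime to 6, since 2^k 3^l − 1 is not smooth
  initial : AtLeast3 A → Family 0
  initial (a , b , c , Aa , Ab , Ac , a≢b , a≢c , b≢c)
    with other-than (2 ^ k) (3 ^ l) Aa Ab Ac a≢b a≢c b≢c
  ... | w , Aw , w≢2^k , w≢3^l
    with fresh-or-smooth [] (2 ^ k ∷ 3 ^ l ∷ []) (pair∈𝒫⋆ Aw w≢2^k w≢3^l) (<⇒≤ 2<∏pair) []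
  ... | inj₁ (z , Az , 2∤z , 3∤z , _) = record
    { elems = z ∷ [] ; inA = Az ∷ [] ; distinct = [] ∷ []
    ; 2∤elems = 2∤z ∷ [] ; 3∤elems = 3∤z ∷ [] ; size = s≤s z≤n }
  ... | inj₂ smooth = ⊥-elim (multiple-of-6-pred-not-smooth 2<∏pair 2∣∏pair 3∣∏pair smooth)

  -- Enlarging a family O with product R: the candidates 2^k·O, 3^l·O and O
  -- are proper subsets of A (missing 3^l, 2^k and 2^k respectively); if
  -- none yields a fresh element, the three smooth equations contradict
  -- no-smooth-solution.
  module Enlarge {n} (F : Family n) where
    open Family F

    R : ℕ
    R = product elems

    member : ∃[ x ] (x ∈ elems)
    member = nonempty-member (≤-trans (s≤s z≤n) size)

    2≤R : 2 ≤ R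
    2≤R = member⇒product≥2 (All.map (λ {x} Ax → prime-power≥2 (isPP x Ax)) inA) (proj₂ member)

    1≤R : 1 ≤ R
    1≤R = <-trans z<s 2≤R

    2∤R : ¬ 2 ∣ R
    2∤R = prime∤product prime[2] 2∤elems

    elems∣ : ∀ u → All (_∣ u * R) elems
    elems∣ u = All.tabulate (λ x∈elems → ∣n⇒∣m*n u (∈⇒∣product x∈elems))

    with-2^k : FinNonemptyProperSubset A (2 ^ k ∷ elems)
    with-2^k = record
      { distinct = 2^k∉ 2∤elems ∷ distinct ; inA = A[2^k] ∷ inA ; nonempty = 2 ^ k , here refl
      ; proper = 3 ^ l , A[3^l] , λ { (here eq) → 2^k≢3^l (sym eq)
                                    ; (there 3^l∈) → All.lookup (3^l∉ 3∤elems) 3^l∈ refl } }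

    with-3^l : FinNonemptyProperSubset A (3 ^ l ∷ elems)
    with-3^l = record
      { distinct = 3^l∉ 3∤elems ∷ distinct ; inA = A[3^l] ∷ inA ; nonempty = 3 ^ l , here refl
      ; proper = 2 ^ k , A[2^k] , λ { (here eq) → 2^k≢3^l eq
                                    ; (there 2^k∈) → All.lookup (2^k∉ 2∤elems) 2^k∈ refl } }

    alone : FinNonemptyProperSubset A elems
    alone = record
      { distinct = distinct ; inA = inA ; nonempty = member
      ; proper = 2 ^ k , A[2^k] , λ 2^k∈ → All.lookup (2^k∉ 2∤elems) 2^k∈ refl }

    2^kR≥1 : 1 ≤ 2 ^ k * R
    2^kR≥1 = *-mono-≤ (m^n>0 2 k) 1≤R

    3^lR≥1 : 1 ≤ 3 ^ l * R
    3^lR≥1 = *-mono-≤ (m^n>0 3 l) 1≤R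

    from-candidates : Fresh elems ⊎ Smooth (2 ^ k * R ∸ 1) → Fresh elems ⊎ Smooth (3 ^ l * R ∸ 1) →
      Fresh elems ⊎ Smooth (R ∸ 1) → Family (suc n)
    from-candidates (inj₁ z) _ _ = adjoin F z
    from-candidates _ (inj₁ z) _ = adjoin F z
    from-candidates _ _ (inj₁ z) = adjoin F z
    from-candidates (inj₂ (α₁ , β₁ , eq₁)) (inj₂ (α₂ , β₂ , eq₂)) (inj₂ (α₃ , β₃ , eq₃)) =
      ⊥-elim (no-smooth-solution k l α₂ β₁ α₃ β₃ k≥1 l≥1 2∤R (pred-inverse 1≤R eq₃)
        (even-pred-smooth α₁ β₁ 2^kR≥1 (∣m⇒∣m*n R (r∣r^ 2 k k≥1)) eq₁)
        (three-pred-smooth α₂ β₂ 3^lR≥1 (∣m⇒∣m*n R (r∣r^ 3 l l≥1)) eq₂))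

    enlarged : Family (suc n)
    enlarged = from-candidates
      (fresh-or-smooth elems (2 ^ k ∷ elems) with-2^k (*-mono-≤ (m^n>0 2 k) 2≤R) (elems∣ (2 ^ k)))
      (fresh-or-smooth elems (3 ^ l ∷ elems) with-3^l (*-mono-≤ (m^n>0 3 l) 2≤R) (elems∣ (3 ^ l)))
      (fresh-or-smooth elems elems alone 2≤R (All.tabulate ∈⇒∣product))

  family : AtLeast3 A → ∀ n → Family n
  family at zero    = initial at
  family at (suc n) = Enlarge.enlarged (family at n)

  -- step (3): apply step (1) to 2^k, 3^l and a family of more than p elements
  every-prime-divides : AtLeast3 A → ∀ p → Prime p → ∃[ a ] (A a × p ∣ a)
  every-prime-divides at p pp =
    prime-divides-member pp (2 ^ k) (3 ^ l ∷ elems)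
      ((2^k≢3^l ∷ 2^k∉ 2∤elems) ∷ (3^l∉ 3∤elems ∷ distinct)) (A[2^k] ∷ A[3^l] ∷ inA)
      (≤-trans (<⇒≤ size) (m≤n+m (length elems) 2))
    where open Family (family at p)

lemma9 : (A : Subset) → (∀ a → A a → IsPrimePower a) → AtLeast3 A → ClosedHyp A →
    ((p : ℕ) → Prime p → ∃[ a ] (A a × p ∣ a))
    × ((∀ a → A a → Prime a) → (p : ℕ) → Prime p → A p)
lemma9 A isPP at H = every-prime , primes-only
  where
  open Growth A isPP H (Pigeonhole.anchors A H isPP at)
  every-prime : (p : ℕ) → Prime p → ∃[ a ] (A a × p ∣ a)
  every-prime = every-prime-divides at
  primes-only : (∀ a → A a → Prime a) → (p : ℕ) → Prime p → A p
  primes-only allPrime p pp with every-prime p pp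
  ... | a , Aa , p∣a = subst A (sym (prime∣prime⇒≡ pp (allPrime a Aa) p∣a)) Aa
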